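{- Let $\mathbf{G3X}$ be any one of the calculi $\mathbf{G3E}$, $\mathbf{G3EN}$, $\mathbf{G3M}$, $\mathbf{G3MN}$, $\mathbf{G3C}$, $\mathbf{G3CN}$, $\mathbf{G3R}$, $\mathbf{G3K}$, $\mathbf{G3ED^\bot}$, $\mathbf{G3END^\bot}$, $\mathbf{G3ED^\Diamond}$, $\mathbf{G3ED}$, $\mathbf{G3END}$, $\mathbf{G3MD^\bot}$, $\mathbf{G3MND^\bot}$, $\mathbf{G3MD}$, $\mathbf{G3MND}$, $\mathbf{G3CD^\Diamond}$, $\mathbf{G3CD}$, $\mathbf{G3CND}$, $\mathbf{G3RD}$, $\mathbf{G3KD}$. The contraction rules $LC$: from $A,A,\Gamma\Rightarrow\Delta$ infer $A,\Gamma\Rightarrow\Delta$, and $RC$: from $\Gamma\Rightarrow\Delta,A,A$ infer $\Gamma\Rightarrow\Delta,A$, are height-preserving admissible in $\mathbf{G3X}$: if the premiss has a derivation of height $h$ in $\mathbf{G3X}$ then the conclusion has a derivation in $\mathbf{G3X}$ of height at most $h$.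
   Context: Formulas are generated from countably many propositional variables $p_0,p_1,\dots$ and the $0$-ary constant $\bot$ by the binary connectives $\wedge,\vee,\supset$ and the unary operator $\Box$; $\neg A:=A\supset\bot$, $\top:=\bot\supset\bot$, $\Diamond A:=\neg\Box\neg A$. A sequent is an expression $\Gamma\Rightarrow\Delta$ with $\Gamma,\Delta$ finite, possibly empty, multisets of formulas; if $\Pi=A_1,\dots,A_m$ then $\Box\Pi=\Box A_1,\dots,\Box A_m$. The calculus $\mathbf{G3cp}$ has initial sequents $p,\Gamma\Rightarrow\Delta,p$ ($p$ a propositional variable), the zero-premiss rule $L\bot$ with conclusion $\bot,\Gamma\Rightarrow\Delta$, and the rules (premisses / conclusion): $L\wedge$: $A,B,\Gamma\Rightarrow\Delta$ / $A\wedge B,\Gamma\Rightarrow\Delta$; $R\wedge$: $\Gamma\Rightarrow\Delta,A$ and $\Gamma\Rightarrow\Delta,B$ / $\Gamma\Rightarrow\Delta,A\wedge B$; $L\vee$: $A,\Gamma\Rightarrow\Delta$ and $B,\Gamma\Rightarrow\Delta$ / $A\vee B,\Gamma\Rightarrow\Delta$; $R\vee$: $\Gamma\Rightarrow\Delta,A,B$ / $\Gamma\Rightarrow\Delta,A\vee B$; $L\supset$: $\Gamma\Rightarrow\Delta,A$ and $B,\Gamma\Rightarrow\Delta$ / $A\supset B,\Gamma\Rightarrow\Delta$; $R\supset$: $A,\Gamma\Rightarrow\Delta,B$ / $\Gamma\Rightarrow\Delta,A\supset B$. Modal and deontic rules ($\Gamma,\Delta$ arbitrary multisets): $LR$-$E$: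 $A\Rightarrow B$ and $B\Rightarrow A$ / $\Box A,\Gamma\Rightarrow\Delta,\Box B$; $LR$-$M$: $A\Rightarrow B$ / $\Box A,\Gamma\Rightarrow\Delta,\Box B$; $LR$-$R$: $A,\Pi\Rightarrow B$ / $\Box A,\Box\Pi,\Gamma\Rightarrow\Delta,\Box B$; $LR$-$C$ (for each $n\ge1$): $A_1,\dots,A_n\Rightarrow B$ and $B\Rightarrow A_1$, …, $B\Rightarrow A_n$ / $\Box A_1,\dots,\Box A_n,\Gamma\Rightarrow\Delta,\Box B$; $LR$-$K$: $\Pi\Rightarrow B$ / $\Box\Pi,\Gamma\Rightarrow\Delta,\Box B$; $R$-$N$: $\Rightarrow B$ / $\Gamma\Rightarrow\Delta,\Box B$; $L$-$D^\bot$: $A\Rightarrow$ / $\Box A,\Gamma\Rightarrow\Delta$; $L$-$D^{\Diamond_E}$ ($|\Pi|\le2$): $\Pi\Rightarrow$ and $\Rightarrow\Pi$ / $\Box\Pi,\Gamma\Rightarrow\Delta$; $L$-$D^{\Diamond_M}$ ($|\Pi|\le2$): $\Pi\Rightarrow$ / $\Box\Pi,\Gamma\Rightarrow\Delta$; $L$-$D^{\Diamond_C}$: $\Pi,\Sigma\Rightarrow$ and $\Rightarrow A,B$ for every $A\in\Pi$, $B\in\Sigma$ / $\Box\Pi,\Box\Sigma,\Gamma\Rightarrow\Delta$; $L$-$D^*$: $\Pi\Rightarrow$ / $\Box\Pi,\Gamma\Rightarrow\Delta$. Each calculus is $\mathbf{G3cp}$ plus: $\mathbf{G3E}$: $LR$-$E$;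 $\mathbf{G3EN}$: $LR$-$E$, $R$-$N$; $\mathbf{G3M}$: $LR$-$M$; $\mathbf{G3MN}$: $LR$-$M$, $R$-$N$; $\mathbf{G3C}$: $LR$-$C$; $\mathbf{G3CN}$: $LR$-$C$, $R$-$N$; $\mathbf{G3R}$: $LR$-$R$; $\mathbf{G3K}$: $LR$-$K$; $\mathbf{G3ED^\bot}$ / $\mathbf{G3END^\bot}$: rules of $\mathbf{G3E}$ / $\mathbf{G3EN}$ plus $L$-$D^\bot$; $\mathbf{G3ED^\Diamond}$: rules of $\mathbf{G3E}$ plus $L$-$D^{\Diamond_E}$; $\mathbf{G3ED}$ / $\mathbf{G3END}$: rules of $\mathbf{G3E}$ / $\mathbf{G3EN}$ plus $L$-$D^\bot$ and $L$-$D^{\Diamond_E}$; $\mathbf{G3MD^\bot}$ / $\mathbf{G3MND^\bot}$: rules of $\mathbf{G3M}$ / $\mathbf{G3MN}$ plus $L$-$D^\bot$; $\mathbf{G3MD}$ / $\mathbf{G3MND}$: rules of $\mathbf{G3M}$ / $\mathbf{G3MN}$ plus $L$-$D^{\Diamond_M}$; $\mathbf{G3CD^\Diamond}$: rules of $\mathbf{G3C}$ plus $L$-$D^{\Diamond_C}$; $\mathbf{G3CD}$, $\mathbf{G3CND}$, $\mathbf{G3RD}$, $\mathbf{G3KD}$: rules of $\mathbf{G3C}$, $\mathbf{G3CN}$, $\mathbf{G3R}$, $\mathbf{G3K}$ respectively plus $L$-$D^*$. A derivation is a finite upward-growing tree of sequents whose leaves are initial sequents or conclusions of $L\bot$ and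 each other node is the conclusion of a rule instance whose premisses are its children. The height of a derivation is the length of its longest branch minus one. -}

module Defs where

open import Data.Nat using (ℕ; zero; suc; _≤_; _⊔_)
open import Data.Bool using (Bool; true; false; T)
open import Data.List using (List; []; _∷_; _++_; map; length)
open import Data.List.Relation.Unary.All as All using (All)
open import Data.List.Relation.Binary.Permutation.Propositional using (_↭_)

infixr 8 _∧'_
infixr 7 _∨'_
infixr 6 _⊃_
data Fm : Set where
  var  : ℕ → Fm
  ⊥'   : Fm
  _∧'_ : Fm → Fm → Fm
  _∨'_ : Fm → Fm → Fm
  _⊃_  : Fm → Fm → Fm
  □    : Fm → Fm

-- Sequents Γ ⇒ Δ.  Γ, Δ are multisets, represented by lists; every rule
-- accepts as its conclusion any sequent whose antecedent/succedent is a
-- permutation (↭) of the displayed one, so derivability only depends on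
-- the underlying multisets.  We write the multiset "Δ,A" as "A ∷ Δ".
infix 3 _⇒_
data Seq : Set where
  _⇒_ : List Fm → List Fm → Seq

□s : List Fm → List Fm
□s = map □

data Calculus : Set where
  G3E G3EN G3M G3MN G3C G3CN G3R G3K : Calculus
  G3ED⊥ G3END⊥ G3ED◇ G3ED G3END : Calculus
  G3MD⊥ G3MND⊥ G3MD G3MND : Calculus
  G3CD◇ G3CD G3CND G3RD G3KD : Calculus

hasE : Calculus → Bool
hasE G3E = true
hasE G3EN = true
hasE G3ED⊥ = true
hasE G3END⊥ = true
hasE G3ED◇ = true
hasE G3ED = true
hasE G3END = true
hasE _ = false

hasM : Calculus → Bool
hasM G3M = true
hasM G3MN = true
hasM G3MD⊥ = true
hasM G3MND⊥ = true
hasM G3MD = true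
hasM G3MND = true
hasM _ = false

hasC : Calculus → Bool
hasC G3C = true
hasC G3CN = true
hasC G3CD◇ = true
hasC G3CD = true
hasC G3CND = true
hasC _ = false

hasR : Calculus → Bool
hasR G3R = true
hasR G3RD = true
hasR _ = false

hasK : Calculus → Bool
hasK G3K = true
hasK G3KD = true
hasK _ = false

hasN : Calculus → Bool
hasN G3EN = true
hasN G3MN = true
hasN G3CN = true
hasN G3END⊥ = true
hasN G3END = true
hasN G3MND⊥ = true
hasN G3MND = true
hasN G3CND = true
hasN _ = false

hasD⊥ : Calculus → Bool
hasD⊥ G3ED⊥ = true
hasD⊥ G3END⊥ = true
hasD⊥ G3ED = true
hasD⊥ G3END = true
hasD⊥ G3MD⊥ = true
hasD⊥ G3MND⊥ = true
hasD⊥ _ = false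

hasD◇E : Calculus → Bool
hasD◇E G3ED◇ = true
hasD◇E G3ED = true
hasD◇E G3END = true
hasD◇E _ = false

hasD◇M : Calculus → Bool
hasD◇M G3MD = true
hasD◇M G3MND = true
hasD◇M _ = false

hasD◇C : Calculus → Bool
hasD◇C G3CD◇ = true
hasD◇C _ = false

hasD* : Calculus → Bool
hasD* G3CD = true
hasD* G3CND = true
hasD* G3RD = true
hasD* G3KD = true
hasD* _ = false

data Deriv (X : Calculus) : Seq → Set where
  init : ∀ {Γ Δ Γ' Δ'} n → Γ' ↭ (var n ∷ Γ) → Δ' ↭ (var n ∷ Δ) →
         Deriv X (Γ' ⇒ Δ')
  L⊥   : ∀ {Γ Γ' Δ} → Γ' ↭ (⊥' ∷ Γ) → Deriv X (Γ' ⇒ Δ)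
  L∧   : ∀ {A B Γ Γ' Δ} → Γ' ↭ (A ∧' B ∷ Γ) →
         Deriv X (A ∷ B ∷ Γ ⇒ Δ) → Deriv X (Γ' ⇒ Δ)
  R∧   : ∀ {A B Γ Δ Δ'} → Δ' ↭ (A ∧' B ∷ Δ) →
         Deriv X (Γ ⇒ A ∷ Δ) → Deriv X (Γ ⇒ B ∷ Δ) → Deriv X (Γ ⇒ Δ')
  L∨   : ∀ {A B Γ Γ' Δ} → Γ' ↭ (A ∨' B ∷ Γ) →
         Deriv X (A ∷ Γ ⇒ Δ) → Deriv X (B ∷ Γ ⇒ Δ) → Deriv X (Γ' ⇒ Δ)
  R∨   : ∀ {A B Γ Δ Δ'} → Δ' ↭ (A ∨' B ∷ Δ) →
         Deriv X (Γ ⇒ A ∷ B ∷ Δ) → Deriv X (Γ ⇒ Δ')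
  L⊃   : ∀ {A B Γ Γ' Δ} → Γ' ↭ (A ⊃ B ∷ Γ) →
         Deriv X (Γ ⇒ A ∷ Δ) → Deriv X (B ∷ Γ ⇒ Δ) → Deriv X (Γ' ⇒ Δ)
  R⊃   : ∀ {A B Γ Δ Δ'} → Δ' ↭ (A ⊃ B ∷ Δ) →
         Deriv X (A ∷ Γ ⇒ B ∷ Δ) → Deriv X (Γ ⇒ Δ')
  LR-E : T (hasE X) → ∀ {A B Γ Γ' Δ Δ'} →
         Γ' ↭ (□ A ∷ Γ) → Δ' ↭ (□ B ∷ Δ) →
         Deriv X (A ∷ [] ⇒ B ∷ []) → Deriv X (B ∷ [] ⇒ A ∷ []) →
         Deriv X (Γ' ⇒ Δ')
  LR-M : T (hasM X) → ∀ {A B Γ Γ' Δ Δ'} →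
         Γ' ↭ (□ A ∷ Γ) → Δ' ↭ (□ B ∷ Δ) →
         Deriv X (A ∷ [] ⇒ B ∷ []) → Deriv X (Γ' ⇒ Δ')
  LR-R : T (hasR X) → ∀ {A Π B Γ Γ' Δ Δ'} →
         Γ' ↭ (□ A ∷ □s Π ++ Γ) → Δ' ↭ (□ B ∷ Δ) →
         Deriv X (A ∷ Π ⇒ B ∷ []) → Deriv X (Γ' ⇒ Δ')
  -- LR-C, n ≥ 1: the list A₁,…,Aₙ is (A ∷ As)
  LR-C : T (hasC X) → ∀ {A As B Γ Γ' Δ Δ'} →
         Γ' ↭ (□s (A ∷ As) ++ Γ) → Δ' ↭ (□ B ∷ Δ) →
         Deriv X (A ∷ As ⇒ B ∷ []) →
         All (λ C → Deriv X (B ∷ [] ⇒ C ∷ [])) (A ∷ As) →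
         Deriv X (Γ' ⇒ Δ')
  LR-K : T (hasK X) → ∀ {Π B Γ Γ' Δ Δ'} →
         Γ' ↭ (□s Π ++ Γ) → Δ' ↭ (□ B ∷ Δ) →
         Deriv X (Π ⇒ B ∷ []) → Deriv X (Γ' ⇒ Δ')
  R-N  : T (hasN X) → ∀ {B Γ Δ Δ'} → Δ' ↭ (□ B ∷ Δ) →
         Deriv X ([] ⇒ B ∷ []) → Deriv X (Γ ⇒ Δ')
  L-D⊥ : T (hasD⊥ X) → ∀ {A Γ Γ' Δ} → Γ' ↭ (□ A ∷ Γ) →
         Deriv X (A ∷ [] ⇒ []) → Deriv X (Γ' ⇒ Δ)
  L-D◇E : T (hasD◇E X) → ∀ {Π Γ Γ' Δ} → length Π ≤ 2 →
          Γ' ↭ (□s Π ++ Γ) →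
          Deriv X (Π ⇒ []) → Deriv X ([] ⇒ Π) → Deriv X (Γ' ⇒ Δ)
  L-D◇M : T (hasD◇M X) → ∀ {Π Γ Γ' Δ} → length Π ≤ 2 →
          Γ' ↭ (□s Π ++ Γ) →
          Deriv X (Π ⇒ []) → Deriv X (Γ' ⇒ Δ)
  L-D◇C : T (hasD◇C X) → ∀ {Π Σ Γ Γ' Δ} →
          Γ' ↭ (□s Π ++ □s Σ ++ Γ) →
          Deriv X (Π ++ Σ ⇒ []) →
          All (λ A → All (λ B → Deriv X ([] ⇒ A ∷ B ∷ [])) Σ) Π →
          Deriv X (Γ' ⇒ Δ)
  L-D* : T (hasD* X) → ∀ {Π Γ Γ' Δ} → Γ' ↭ (□s Π ++ Γ) →
         Deriv X (Π ⇒ []) → Deriv X (Γ' ⇒ Δ)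

-- Height: length of the longest branch minus one
-- (leaves have height 0, a node has height 1 + max of its children).
mutual
  height : ∀ {X s} → Deriv X s → ℕ
  height (init _ _ _) = 0
  height (L⊥ _) = 0
  height (L∧ _ d) = suc (height d)
  height (R∧ _ d e) = suc (height d ⊔ height e)
  height (L∨ _ d e) = suc (height d ⊔ height e)
  height (R∨ _ d) = suc (height d)
  height (L⊃ _ d e) = suc (height d ⊔ height e)
  height (R⊃ _ d) = suc (height d)
  height (LR-E _ _ _ d e) = suc (height d ⊔ height e)
  height (LR-M _ _ _ d) = suc (height d)
  height (LR-R _ _ _ d) = suc (height d)
  height (LR-C _ _ _ d ds) = suc (height d ⊔ heightAll ds)
  height (LR-K _ _ _ d) = suc (height d)
  height (R-N _ _ d) = suc (height d)
  height (L-D⊥ _ _ d) = suc (height d)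
  height (L-D◇E _ _ _ d e) = suc (height d ⊔ height e)
  height (L-D◇M _ _ _ d) = suc (height d)
  height (L-D◇C _ _ d dss) = suc (height d ⊔ heightAll² dss)
  height (L-D* _ _ d) = suc (height d)

  heightAll : ∀ {X} {P : Fm → Seq} {xs} → All (λ x → Deriv X (P x)) xs → ℕ
  heightAll All.[] = 0
  heightAll (d All.∷ ds) = height d ⊔ heightAll ds

  heightAll² : ∀ {X} {P : Fm → Fm → Seq} {xs ys} →
               All (λ x → All (λ y → Deriv X (P x y)) ys) xs → ℕ
  heightAll² All.[] = 0
  heightAll² (ds All.∷ dss) = heightAll ds ⊔ heightAll² dss

module Submission where

-- A modal rule only looks at its boxed principal formulas, the rest of the
-- conclusion being weakening context; 'ModalEnd' records this once, so the
-- modal rules are treated uniformly.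
-- Contraction then follows by induction on a height bound: a formula that
-- is principal in a propositional rule is handled by inverting the premisses
-- and contracting the components; two principal copies in a modal rule by
-- contracting the premisses of the rule; otherwise the copies are
-- contracted in the premisses.

open import Defs
open import Data.Nat using (_≤_)
open import Data.Product using (Σ-syntax; _×_)
open import Data.List using (_∷_)

open import Data.Bool using (T)
open import Data.Empty using (⊥; ⊥-elim)
open import Data.List using (List; []; [_]; _++_; map; length)
open import Data.List.Properties using (map-++; ++-assoc)
open import Data.List.Membership.Propositional using (_∈_)
open import Data.List.Membership.Propositional.Properties
  using (∈-map⁻; ∈-++⁻; ∈-∃++)
open import Data.List.Relation.Binary.Subset.Propositional using (_⊆_)
open import Data.List.Relation.Unary.All as All using (All)
open import Data.List.Relation.Unary.Any using (here; there)
open import Data.List.Relation.Binary.Permutation.Propositional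
  using (_↭_; ↭-refl; ↭-prep; ↭-swap; ↭-sym; ↭-trans; ↭-reflexive)
open import Data.List.Relation.Binary.Permutation.Propositional.Properties
  using (∈-resp-↭; map⁺; ↭-length; ++⁺ˡ; ++⁺ʳ; shift; shifts; drop-∷)
open import Data.Nat using (ℕ; zero; suc; _<_; _⊔_; z≤n; s≤s)
open import Data.Nat.Properties
  using ( ≤-refl; ≤-trans; ≤-pred; n≤1+n; ⊔-lub; ⊔-mono-≤; m≤m⊔n; m≤n⊔m; m≤n⇒m≤o⊔n
        ; m⊔n<o⇒m<o; m⊔n<o⇒n<o)
open import Data.Product using (_,_; proj₁; proj₂)
open import Data.Sum using (_⊎_; inj₁; inj₂)
open import Function using (_∘_; _$_)
open import Function.Definitions using (Injective)
open import Relation.Binary.PropositionalEquality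
  using (_≡_; _≢_; refl; cong; sym; trans; subst)

module _ {a} {A : Set a} where

  ↭-sym-trans : ∀ {xs ys zs : List A} → xs ↭ ys → xs ↭ zs → ys ↭ zs
  ↭-sym-trans p q = ↭-trans (↭-sym p) q

  prefix-↭ : ∀ G H {xs ys : List A} → xs ↭ H ++ ys → G ++ xs ↭ H ++ G ++ ys
  prefix-↭ G H p = ↭-trans (++⁺ˡ G p) (shifts G H)

  ∈⇒↭ : ∀ {x : A} {xs} → x ∈ xs → Σ[ ys ∈ List A ] xs ↭ x ∷ ys
  ∈⇒↭ x∈xs with ys , zs , refl ← ∈-∃++ x∈xs = ys ++ zs , shift _ ys zs

  ↭-tail-⊆ : ∀ {x : A} {xs ys} → xs ↭ x ∷ ys → ys ⊆ xs
  ↭-tail-⊆ p y∈ys = ∈-resp-↭ (↭-sym p) (there y∈ys)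

  ∷-↭-inv : ∀ {x y : A} {xs ys} → x ∷ xs ↭ y ∷ ys →
            (x ≡ y × xs ↭ ys) ⊎ Σ[ zs ∈ List A ] (ys ↭ x ∷ zs × xs ↭ y ∷ zs)
  ∷-↭-inv {x} {y} p with ∈-resp-↭ p (here refl)
  ... | here refl = inj₁ (refl , drop-∷ p)
  ... | there x∈ys =
    let (zs , q) = ∈⇒↭ x∈ys in
    inj₂ (zs , q , drop-∷ (↭-trans p (prefix-↭ [ y ] [ x ] q)))

  ∷∷-↭-inv : ∀ {x y : A} {xs ys} → x ∷ x ∷ xs ↭ y ∷ ys →
             (x ≡ y × ys ↭ x ∷ xs) ⊎ Σ[ zs ∈ List A ] (ys ↭ x ∷ x ∷ zs × xs ↭ y ∷ zs)
  ∷∷-↭-inv {x} p with ∷-↭-inv p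
  ... | inj₁ (x≡y , q) = inj₁ (x≡y , ↭-sym q)
  ... | inj₂ (zs , q , r) with ∷-↭-inv r
  ...   | inj₁ (x≡y , s) = inj₁ (x≡y , ↭-trans q (↭-prep x (↭-sym s)))
  ...   | inj₂ (ws , t , u) = inj₂ (ws , ↭-trans q (↭-prep x t) , u)

  ∷∷-↭-drop : ∀ {x y : A} {xs ys} → x ∷ x ∷ xs ↭ y ∷ ys → Σ[ zs ∈ List A ] x ∷ xs ↭ y ∷ zs
  ∷∷-↭-drop {x} {y} {xs} p with ∷∷-↭-inv p
  ... | inj₁ (refl , _) = xs , ↭-refl
  ... | inj₂ (zs , _ , u) = x ∷ zs , prefix-↭ [ x ] [ y ] u

  ≤1-no-copies : ∀ {x : A} {xs ys} → length xs ≤ 1 → xs ↭ x ∷ x ∷ ys → ⊥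
  ≤1-no-copies len p with subst (_≤ 1) (↭-length p) len
  ... | s≤s ()

  contracted-length : ∀ {x : A} {xs ys k} → length xs ≤ k → xs ↭ x ∷ x ∷ ys → length (x ∷ ys) ≤ k
  contracted-length len p = ≤-trans (n≤1+n _) (subst (_≤ _) (↭-length p) len)

  ∈-++-remove : ∀ {x : A} xs ys → x ∈ xs ++ ys →
    Σ[ xs′ ∈ List A ] Σ[ ys′ ∈ List A ] (xs ++ ys ↭ x ∷ xs′ ++ ys′ × xs′ ⊆ xs × ys′ ⊆ ys)
  ∈-++-remove {x} xs ys x∈ with ∈-++⁻ xs x∈
  ... | inj₁ x∈xs =
    let (xs′ , p) = ∈⇒↭ x∈xs in xs′ , ys , ++⁺ʳ ys p , ↭-tail-⊆ p , λ y∈ → y∈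
  ... | inj₂ x∈ys =
    let (ys′ , p) = ∈⇒↭ x∈ys in xs , ys′ , prefix-↭ xs [ x ] p , (λ y∈ → y∈) , ↭-tail-⊆ p

module _ {a b} {A : Set a} {B : Set b} (f : A → B) where

  locate : ∀ {y xs} L {zs} → y ∷ xs ↭ map f L ++ zs →
           (Σ[ ws ∈ List B ] (zs ↭ y ∷ ws × xs ↭ map f L ++ ws)) ⊎
           (Σ[ x ∈ A ] Σ[ L₁ ∈ List A ] (y ≡ f x × L ↭ x ∷ L₁ × xs ↭ map f L₁ ++ zs))
  locate {y} L {zs} p with ∈-++⁻ (map f L) (∈-resp-↭ p (here refl))
  ... | inj₂ y∈zs =
    let (ws , q) = ∈⇒↭ y∈zs in
    inj₁ (ws , q , drop-∷ (↭-trans p (prefix-↭ (map f L) [ y ] q)))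
  ... | inj₁ y∈fL with ∈-map⁻ f y∈fL
  ...   | x , x∈L , refl =
    let (L₁ , r) = ∈⇒↭ x∈L in
    inj₂ (x , L₁ , refl , r , drop-∷ (↭-trans p (++⁺ʳ zs (map⁺ f r))))

  outside-image : ∀ {y xs} L {zs} → (∀ x → y ≢ f x) → y ∷ xs ↭ map f L ++ zs →
                  Σ[ ws ∈ List B ] xs ↭ map f L ++ ws
  outside-image L y∉ p with locate L p
  ... | inj₁ (ws , _ , q) = ws , q
  ... | inj₂ (x , _ , y≡fx , _) = ⊥-elim (y∉ x y≡fx)

  two-copies : Injective _≡_ _≡_ f → ∀ {y xs} L {zs} → y ∷ y ∷ xs ↭ map f L ++ zs →
               (Σ[ ws ∈ List B ] y ∷ xs ↭ map f L ++ ws) ⊎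
               (Σ[ x ∈ A ] Σ[ L₂ ∈ List A ] (y ≡ f x × L ↭ x ∷ x ∷ L₂ × xs ↭ map f L₂ ++ zs))
  two-copies f-inj L p with locate L p
  ... | inj₁ (ws , _ , q) = inj₁ (ws , q)
  ... | inj₂ (x , L₁ , refl , r , q) with locate L₁ q
  ...   | inj₁ (ws , _ , s) = inj₁ (ws , ↭-trans (↭-prep (f x) s) (++⁺ʳ ws (map⁺ f (↭-sym r))))
  ...   | inj₂ (x′ , L₂ , fx≡fx′ , r′ , s) with f-inj fx≡fx′
  ...     | refl = inj₂ (x , L₂ , refl , ↭-trans r (↭-prep x r′) , s)

⊔-<ˡ : ∀ {a b n} → a ⊔ b < n → a < n
⊔-<ˡ = m⊔n<o⇒m<o _ _

⊔-<ʳ : ∀ {a b n} → a ⊔ b < n → b < n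
⊔-<ʳ = m⊔n<o⇒n<o _ _

□-injective : Injective _≡_ _≡_ □
□-injective refl = refl

□s-++ : ∀ Π Ψ {W} → □s (Π ++ Ψ) ++ W ≡ □s Π ++ □s Ψ ++ W
□s-++ Π Ψ {W} = trans (cong (_++ W) (map-++ □ Π Ψ)) (++-assoc (□s Π) (□s Ψ) W)

module _ (X : Calculus) where

  Deriv≤ : Seq → ℕ → Set
  Deriv≤ s m = Σ[ d ∈ Deriv X s ] height d ≤ m

  tight : ∀ {s} (d : Deriv X s) → Deriv≤ s (height d)
  tight d = d , ≤-refl

  loosen : ∀ {s k m} → k ≤ m → Deriv≤ s k → Deriv≤ s m
  loosen k≤m (d , h) = d , ≤-trans h k≤m

  lookup-deriv : ∀ {P : Fm → Seq} {xs x} (ds : All (λ y → Deriv X (P y)) xs) → x ∈ xs →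
                 Deriv≤ (P x) (heightAll ds)
  lookup-deriv (d All.∷ ds) (here refl) = d , m≤m⊔n _ _
  lookup-deriv (d All.∷ ds) (there x∈) = let (d′ , k) = lookup-deriv ds x∈ in d′ , m≤n⇒m≤o⊔n _ k

  restrict : ∀ {P : Fm → Seq} {xs ys} → ys ⊆ xs → (ds : All (λ y → Deriv X (P y)) xs) →
             Σ[ ds′ ∈ All (λ y → Deriv X (P y)) ys ] heightAll ds′ ≤ heightAll ds
  restrict {ys = []} _ ds = All.[] , z≤n
  restrict {ys = y ∷ ys} sub ds =
    let (d , k) = lookup-deriv ds (sub (here refl)) ; (ds′ , k′) = restrict (sub ∘ there) ds
    in d All.∷ ds′ , ⊔-lub k k′

  lookup-derivs : ∀ {P : Fm → Fm → Seq} {xs ys x}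
                  (dss : All (λ a → All (λ b → Deriv X (P a b)) ys) xs) →
                  x ∈ xs → Σ[ ds ∈ All (λ b → Deriv X (P x b)) ys ] heightAll ds ≤ heightAll² dss
  lookup-derivs (ds All.∷ dss) (here refl) = ds , m≤m⊔n _ _
  lookup-derivs (ds All.∷ dss) (there x∈) =
    let (ds′ , k) = lookup-derivs dss x∈ in ds′ , m≤n⇒m≤o⊔n _ k

  restrict² : ∀ {P : Fm → Fm → Seq} {xs ys xs′ ys′} → xs′ ⊆ xs → ys′ ⊆ ys →
              (dss : All (λ a → All (λ b → Deriv X (P a b)) ys) xs) →
              Σ[ dss′ ∈ All (λ a → All (λ b → Deriv X (P a b)) ys′) xs′ ]
                heightAll² dss′ ≤ heightAll² dss
  restrict² {xs′ = []} _ _ dss = All.[] , z≤n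
  restrict² {xs′ = x ∷ xs′} subₒ subᵢ dss =
    let (ds , k₁) = lookup-derivs dss (subₒ (here refl))
        (ds′ , k₂) = restrict subᵢ ds
        (dss′ , k₃) = restrict² (subₒ ∘ there) subᵢ dss
    in ds′ All.∷ dss′ , ⊔-lub (≤-trans k₂ k₁) k₃

  -- Height-preserving left and right contraction for heights below n: the
  -- induction hypothesis of the main proof.
  ContractL ContractR : ℕ → Set
  ContractL n = ∀ {m Γ Δ A Γ₀ Γ′} → m < n → Γ ↭ A ∷ A ∷ Γ₀ → Γ′ ↭ A ∷ Γ₀ →
                Deriv≤ (Γ ⇒ Δ) m → Deriv≤ (Γ′ ⇒ Δ) m
  ContractR n = ∀ {m Γ Δ A Δ₀ Δ′} → m < n → Δ ↭ A ∷ A ∷ Δ₀ → Δ′ ↭ A ∷ Δ₀ →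
                Deriv≤ (Γ ⇒ Δ) m → Deriv≤ (Γ ⇒ Δ′) m

  -- The rule has
  -- principal formulas □s principalL ⇒ □s principalR (at most one on the
  -- right) and arbitrary weakening contexts.  So it can be re-applied below
  -- any other contexts, and two principal copies of a formula on the left
  -- can be contracted by contracting the premisses of the rule.
  record ModalEnd {Γ Δ} (d : Deriv X (Γ ⇒ Δ)) : Set where
    field
      principalL principalR contextL contextR : List Fm
      splitL : Γ ↭ □s principalL ++ contextL
      splitR : Δ ↭ □s principalR ++ contextR
      single-right : length principalR ≤ 1
      rebuild : ∀ {Γ′ Δ′ W V} → Γ′ ↭ □s principalL ++ W → Δ′ ↭ □s principalR ++ V →
                Deriv≤ (Γ′ ⇒ Δ′) (height d)
      contract-principal : ∀ {n D L Γ′ Δ′ W V} → principalL ↭ D ∷ D ∷ L → height d ≤ n →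
                           ContractL n → ContractR n →
                           Γ′ ↭ □ D ∷ □s L ++ W → Δ′ ↭ □s principalR ++ V →
                           Deriv≤ (Γ′ ⇒ Δ′) (height d)

  open ModalEnd

  -- Rules with at most one principal formula on each side (LR-E, LR-M, R-N,
  -- L-D⊥) never have two principal copies of a formula.
  single-principal : ∀ {Γ Δ} {d : Deriv X (Γ ⇒ Δ)} L R {W V} →
    length L ≤ 1 → length R ≤ 1 → Γ ↭ □s L ++ W → Δ ↭ □s R ++ V →
    (∀ {Γ′ Δ′ W′ V′} → Γ′ ↭ □s L ++ W′ → Δ′ ↭ □s R ++ V′ → Deriv≤ (Γ′ ⇒ Δ′) (height d)) →
    ModalEnd d
  single-principal L R lenL lenR pl pr rb = record
    { principalL = L ; principalR = R ; contextL = _ ; contextR = _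
    ; splitL = pl ; splitR = pr ; single-right = lenR ; rebuild = rb
    ; contract-principal = λ two → ⊥-elim (≤1-no-copies lenL two) }

  end-LR-R : (t : T (hasR X)) → ∀ {A Π B Γ Γ′ Δ Δ′} (p : Γ′ ↭ □ A ∷ □s Π ++ Γ) (q : Δ′ ↭ □ B ∷ Δ)
             (e : Deriv X (A ∷ Π ⇒ B ∷ [])) → ModalEnd (LR-R t p q e)
  end-LR-R t {A} {Π} {B} p q e = record
    { principalL = A ∷ Π ; principalR = B ∷ [] ; contextL = _ ; contextR = _
    ; splitL = p ; splitR = q ; single-right = ≤-refl
    ; rebuild = λ p′ q′ → tight (LR-R t p′ q′ e)
    ; contract-principal = λ two lt ihL _ p′ q′ →
        let (e′ , k) = ihL lt two ↭-refl (tight e) in LR-R t p′ q′ e′ , s≤s k }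

  end-LR-K : (t : T (hasK X)) → ∀ {Π B Γ Γ′ Δ Δ′} (p : Γ′ ↭ □s Π ++ Γ) (q : Δ′ ↭ □ B ∷ Δ)
             (e : Deriv X (Π ⇒ B ∷ [])) → ModalEnd (LR-K t p q e)
  end-LR-K t {Π} {B} p q e = record
    { principalL = Π ; principalR = B ∷ [] ; contextL = _ ; contextR = _
    ; splitL = p ; splitR = q ; single-right = ≤-refl
    ; rebuild = λ p′ q′ → tight (LR-K t p′ q′ e)
    ; contract-principal = λ two lt ihL _ p′ q′ →
        let (e′ , k) = ihL lt two ↭-refl (tight e) in LR-K t p′ q′ e′ , s≤s k }

  end-L-D* : (t : T (hasD* X)) → ∀ {Π Γ Γ′ Δ} (p : Γ′ ↭ □s Π ++ Γ) (e : Deriv X (Π ⇒ [])) →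
             ModalEnd {Δ = Δ} (L-D* t p e)
  end-L-D* t {Π} p e = record
    { principalL = Π ; principalR = [] ; contextL = _ ; contextR = _
    ; splitL = p ; splitR = ↭-refl ; single-right = z≤n
    ; rebuild = λ p′ _ → tight (L-D* t p′ e)
    ; contract-principal = λ two lt ihL _ p′ _ →
        let (e′ , k) = ihL lt two ↭-refl (tight e) in L-D* t p′ e′ , s≤s k }

  end-L-D◇M : (t : T (hasD◇M X)) → ∀ {Π Γ Γ′ Δ} (l : length Π ≤ 2) (p : Γ′ ↭ □s Π ++ Γ)
              (e : Deriv X (Π ⇒ [])) → ModalEnd {Δ = Δ} (L-D◇M t l p e)
  end-L-D◇M t {Π} l p e = record
    { principalL = Π ; principalR = [] ; contextL = _ ; contextR = _
    ; splitL = p ; splitR = ↭-refl ; single-right = z≤n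
    ; rebuild = λ p′ _ → tight (L-D◇M t l p′ e)
    ; contract-principal = λ two lt ihL _ p′ _ →
        let (e′ , k) = ihL lt two ↭-refl (tight e)
        in L-D◇M t (contracted-length l two) p′ e′ , s≤s k }

  end-L-D◇E : (t : T (hasD◇E X)) → ∀ {Π Γ Γ′ Δ} (l : length Π ≤ 2) (p : Γ′ ↭ □s Π ++ Γ)
              (e₁ : Deriv X (Π ⇒ [])) (e₂ : Deriv X ([] ⇒ Π)) → ModalEnd {Δ = Δ} (L-D◇E t l p e₁ e₂)
  end-L-D◇E t {Π} l p e₁ e₂ = record
    { principalL = Π ; principalR = [] ; contextL = _ ; contextR = _
    ; splitL = p ; splitR = ↭-refl ; single-right = z≤n
    ; rebuild = λ p′ _ → tight (L-D◇E t l p′ e₁ e₂)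
    ; contract-principal = λ two lt ihL ihR p′ _ →
        let (e₁′ , k₁) = ihL (⊔-<ˡ lt) two ↭-refl (tight e₁)
            (e₂′ , k₂) = ihR (⊔-<ʳ lt) two ↭-refl (tight e₂)
        in L-D◇E t (contracted-length l two) p′ e₁′ e₂′ , s≤s (⊔-mono-≤ k₁ k₂) }

  end-LR-C : (t : T (hasC X)) → ∀ {A As B Γ Γ′ Δ Δ′} (p : Γ′ ↭ □s (A ∷ As) ++ Γ) (q : Δ′ ↭ □ B ∷ Δ)
             (e : Deriv X (A ∷ As ⇒ B ∷ [])) (ds : All (λ C → Deriv X (B ∷ [] ⇒ C ∷ [])) (A ∷ As)) →
             ModalEnd (LR-C t p q e ds)
  end-LR-C t {A} {As} {B} p q e ds = record
    { principalL = A ∷ As ; principalR = B ∷ [] ; contextL = _ ; contextR = _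
    ; splitL = p ; splitR = q ; single-right = ≤-refl
    ; rebuild = λ p′ q′ → tight (LR-C t p′ q′ e ds)
    ; contract-principal = λ two lt ihL _ p′ q′ →
        let (e′ , k) = ihL (⊔-<ˡ lt) two ↭-refl (tight e)
            (ds′ , k′) = restrict (↭-tail-⊆ two) ds
        in LR-C t p′ q′ e′ ds′ , s≤s (⊔-mono-≤ k k′) }

  -- L-D◇C: drop one principal copy of □D from whichever of □Π, □Ψ contains
  -- it, contract the premiss Π, Ψ ⇒ and keep the matching side premisses.
  contract-L-D◇C : (t : T (hasD◇C X)) → ∀ {Π Ψ D L n Γ′ W Δ} (e : Deriv X (Π ++ Ψ ⇒ []))
    (dss : All (λ A → All (λ B → Deriv X ([] ⇒ A ∷ B ∷ [])) Ψ) Π) →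
    Π ++ Ψ ↭ D ∷ D ∷ L → suc (height e ⊔ heightAll² dss) ≤ n → ContractL n →
    Γ′ ↭ □ D ∷ □s L ++ W → Deriv≤ (Γ′ ⇒ Δ) (suc (height e ⊔ heightAll² dss))
  contract-L-D◇C t {Π} {Ψ} {W = W} e dss two lt ihL p′ =
    let (Π′ , Ψ′ , split , Π′⊆Π , Ψ′⊆Ψ) = ∈-++-remove Π Ψ (∈-resp-↭ (↭-sym two) (here refl))
        rest = drop-∷ (↭-sym-trans split two)
        (e′ , k) = ihL (⊔-<ˡ lt) two rest (tight e)
        (dss′ , k′) = restrict² Π′⊆Π Ψ′⊆Ψ dss
        p″ = ↭-trans p′ (↭-trans (++⁺ʳ W (map⁺ □ (↭-sym rest))) (↭-reflexive (□s-++ Π′ Ψ′)))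
    in L-D◇C t p″ e′ dss′ , s≤s (⊔-mono-≤ k k′)

  end-L-D◇C : (t : T (hasD◇C X)) → ∀ {Π Ψ Γ Γ′ Δ} (p : Γ′ ↭ □s Π ++ □s Ψ ++ Γ)
              (e : Deriv X (Π ++ Ψ ⇒ []))
              (dss : All (λ A → All (λ B → Deriv X ([] ⇒ A ∷ B ∷ [])) Ψ) Π) →
              ModalEnd {Δ = Δ} (L-D◇C t p e dss)
  end-L-D◇C t {Π} {Ψ} p e dss = record
    { principalL = Π ++ Ψ ; principalR = [] ; contextL = _ ; contextR = _
    ; splitL = ↭-trans p (↭-reflexive (sym (□s-++ Π Ψ))) ; splitR = ↭-refl ; single-right = z≤n
    ; rebuild = λ p′ _ → tight (L-D◇C t (↭-trans p′ (↭-reflexive (□s-++ Π Ψ))) e dss)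
    ; contract-principal = λ two lt ihL _ p′ _ → contract-L-D◇C t e dss two lt ihL p′ }

  data View : ∀ {Γ Δ} → Deriv X (Γ ⇒ Δ) → Set where
    by-init : ∀ {Γ Δ Γ′ Δ′} n (p : Γ′ ↭ var n ∷ Γ) (q : Δ′ ↭ var n ∷ Δ) → View (init n p q)
    by-L⊥ : ∀ {Γ Γ′ Δ} (p : Γ′ ↭ ⊥' ∷ Γ) → View {Δ = Δ} (L⊥ p)
    by-L∧ : ∀ {A B Γ Γ′ Δ} (p : Γ′ ↭ A ∧' B ∷ Γ) (e : Deriv X (A ∷ B ∷ Γ ⇒ Δ)) → View (L∧ p e)
    by-R∧ : ∀ {A B Γ Δ Δ′} (p : Δ′ ↭ A ∧' B ∷ Δ)
            (e₁ : Deriv X (Γ ⇒ A ∷ Δ)) (e₂ : Deriv X (Γ ⇒ B ∷ Δ)) → View (R∧ p e₁ e₂)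
    by-L∨ : ∀ {A B Γ Γ′ Δ} (p : Γ′ ↭ A ∨' B ∷ Γ)
            (e₁ : Deriv X (A ∷ Γ ⇒ Δ)) (e₂ : Deriv X (B ∷ Γ ⇒ Δ)) → View (L∨ p e₁ e₂)
    by-R∨ : ∀ {A B Γ Δ Δ′} (p : Δ′ ↭ A ∨' B ∷ Δ) (e : Deriv X (Γ ⇒ A ∷ B ∷ Δ)) → View (R∨ p e)
    by-L⊃ : ∀ {A B Γ Γ′ Δ} (p : Γ′ ↭ A ⊃ B ∷ Γ)
            (e₁ : Deriv X (Γ ⇒ A ∷ Δ)) (e₂ : Deriv X (B ∷ Γ ⇒ Δ)) → View (L⊃ p e₁ e₂)
    by-R⊃ : ∀ {A B Γ Δ Δ′} (p : Δ′ ↭ A ⊃ B ∷ Δ) (e : Deriv X (A ∷ Γ ⇒ B ∷ Δ)) → View (R⊃ p e)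
    by-modal : ∀ {Γ Δ} {d : Deriv X (Γ ⇒ Δ)} → ModalEnd d → View d

  view : ∀ {Γ Δ} (d : Deriv X (Γ ⇒ Δ)) → View d
  view (init n p q) = by-init n p q
  view (L⊥ p) = by-L⊥ p
  view (L∧ p e) = by-L∧ p e
  view (R∧ p e₁ e₂) = by-R∧ p e₁ e₂
  view (L∨ p e₁ e₂) = by-L∨ p e₁ e₂
  view (R∨ p e) = by-R∨ p e
  view (L⊃ p e₁ e₂) = by-L⊃ p e₁ e₂
  view (R⊃ p e) = by-R⊃ p e
  view (LR-E t {A} {B} p q e₁ e₂) =
    by-modal (single-principal [ A ] [ B ] ≤-refl ≤-refl p q λ p′ q′ → tight (LR-E t p′ q′ e₁ e₂))
  view (LR-M t {A} {B} p q e) =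
    by-modal (single-principal [ A ] [ B ] ≤-refl ≤-refl p q λ p′ q′ → tight (LR-M t p′ q′ e))
  view (R-N t {B} q e) =
    by-modal (single-principal [] [ B ] z≤n ≤-refl ↭-refl q λ _ q′ → tight (R-N t q′ e))
  view (L-D⊥ t {A} p e) =
    by-modal (single-principal [ A ] [] ≤-refl z≤n p ↭-refl λ p′ _ → tight (L-D⊥ t p′ e))
  view (LR-R t p q e) = by-modal (end-LR-R t p q e)
  view (LR-C t p q e ds) = by-modal (end-LR-C t p q e ds)
  view (LR-K t p q e) = by-modal (end-LR-K t p q e)
  view (L-D◇E t l p e₁ e₂) = by-modal (end-L-D◇E t l p e₁ e₂)
  view (L-D◇M t l p e) = by-modal (end-L-D◇M t l p e)
  view (L-D◇C t p e dss) = by-modal (end-L-D◇C t p e dss)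
  view (L-D* t p e) = by-modal (end-L-D* t p e)

  exchange : ∀ {Γ Δ Γ′ Δ′} → Γ′ ↭ Γ → Δ′ ↭ Δ → (d : Deriv X (Γ ⇒ Δ)) → Deriv≤ (Γ′ ⇒ Δ′) (height d)
  exchange g h d with view d
  ... | by-init n p q = init n (↭-trans g p) (↭-trans h q) , z≤n
  ... | by-L⊥ p = L⊥ (↭-trans g p) , z≤n
  ... | by-L∧ p e =
    let (e′ , k) = exchange ↭-refl h e in L∧ (↭-trans g p) e′ , s≤s k
  ... | by-R∧ p e₁ e₂ =
    let (e₁′ , k₁) = exchange g ↭-refl e₁ ; (e₂′ , k₂) = exchange g ↭-refl e₂
    in R∧ (↭-trans h p) e₁′ e₂′ , s≤s (⊔-mono-≤ k₁ k₂)
  ... | by-L∨ p e₁ e₂ =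
    let (e₁′ , k₁) = exchange ↭-refl h e₁ ; (e₂′ , k₂) = exchange ↭-refl h e₂
    in L∨ (↭-trans g p) e₁′ e₂′ , s≤s (⊔-mono-≤ k₁ k₂)
  ... | by-R∨ p e =
    let (e′ , k) = exchange g ↭-refl e in R∨ (↭-trans h p) e′ , s≤s k
  ... | by-L⊃ {A} p e₁ e₂ =
    let (e₁′ , k₁) = exchange ↭-refl (↭-prep A h) e₁ ; (e₂′ , k₂) = exchange ↭-refl h e₂
    in L⊃ (↭-trans g p) e₁′ e₂′ , s≤s (⊔-mono-≤ k₁ k₂)
  ... | by-R⊃ {A} p e =
    let (e′ , k) = exchange (↭-prep A g) ↭-refl e in R⊃ (↭-trans h p) e′ , s≤s k
  ... | by-modal me = rebuild me (↭-trans g (splitL me)) (↭-trans h (splitR me))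

  exchange≤ : ∀ {Γ Δ Γ′ Δ′ m} → Γ′ ↭ Γ → Δ′ ↭ Δ → Deriv≤ (Γ ⇒ Δ) m → Deriv≤ (Γ′ ⇒ Δ′) m
  exchange≤ g h (d , k) = loosen k (exchange g h d)

  record LeftInvertible (F : Fm) (Ga Da : List Fm) : Set where
    field
      not-atom : ∀ n → F ≢ var n
      not-⊥ : F ≢ ⊥'
      not-box : ∀ C → F ≢ □ C
      at-L∧ : ∀ {A B Γ Δ} → F ≡ A ∧' B → (e : Deriv X (A ∷ B ∷ Γ ⇒ Δ)) →
              Deriv≤ (Ga ++ Γ ⇒ Da ++ Δ) (height e)
      at-L∨ : ∀ {A B Γ Δ} → F ≡ A ∨' B → (e₁ : Deriv X (A ∷ Γ ⇒ Δ)) (e₂ : Deriv X (B ∷ Γ ⇒ Δ)) →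
              Deriv≤ (Ga ++ Γ ⇒ Da ++ Δ) (height e₁ ⊔ height e₂)
      at-L⊃ : ∀ {A B Γ Δ} → F ≡ A ⊃ B → (e₁ : Deriv X (Γ ⇒ A ∷ Δ)) (e₂ : Deriv X (B ∷ Γ ⇒ Δ)) →
              Deriv≤ (Ga ++ Γ ⇒ Da ++ Δ) (height e₁ ⊔ height e₂)

  -- Non-principal occurrences of F are
  -- pushed up to the premisses; modal rules carry F in their context.
  module _ {F Ga Da} (I : LeftInvertible F Ga Da) where
    open LeftInvertible I

    invertL : ∀ {Γ Δ Γ₀ Γ′ Δ′} → Γ ↭ F ∷ Γ₀ → Γ′ ↭ Ga ++ Γ₀ → Δ′ ↭ Da ++ Δ →
              (d : Deriv X (Γ ⇒ Δ)) → Deriv≤ (Γ′ ⇒ Δ′) (height d)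
    invertL π g h d with view d
    ... | by-init n p q with ∷-↭-inv (↭-sym-trans π p)
    ...   | inj₁ (F≡var , _) = ⊥-elim (not-atom n F≡var)
    ...   | inj₂ (_ , _ , u) =
      init n (↭-trans g (prefix-↭ Ga [ var n ] u)) (↭-trans h (prefix-↭ Da [ var n ] q)) , z≤n
    invertL π g h d | by-L⊥ p with ∷-↭-inv (↭-sym-trans π p)
    ...   | inj₁ (F≡⊥ , _) = ⊥-elim (not-⊥ F≡⊥)
    ...   | inj₂ (_ , _ , u) = L⊥ (↭-trans g (prefix-↭ Ga [ ⊥' ] u)) , z≤n
    invertL π g h d | by-L∧ {A} {B} p e with ∷-↭-inv (↭-sym-trans π p)
    ...   | inj₁ (F≡A∧B , s) =
      loosen (n≤1+n _) (exchange≤ (↭-trans g (++⁺ˡ Ga s)) h (at-L∧ F≡A∧B e))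
    ...   | inj₂ (_ , t , u) =
      let (e′ , k) = invertL (prefix-↭ (A ∷ B ∷ []) [ F ] t) (shifts (A ∷ B ∷ []) Ga) h e
      in L∧ (↭-trans g (prefix-↭ Ga [ A ∧' B ] u)) e′ , s≤s k
    invertL π g h d | by-R∧ {A} {B} p e₁ e₂ =
      let (e₁′ , k₁) = invertL π g (shifts [ A ] Da) e₁
          (e₂′ , k₂) = invertL π g (shifts [ B ] Da) e₂
      in R∧ (↭-trans h (prefix-↭ Da [ A ∧' B ] p)) e₁′ e₂′ , s≤s (⊔-mono-≤ k₁ k₂)
    invertL π g h d | by-L∨ {A} {B} p e₁ e₂ with ∷-↭-inv (↭-sym-trans π p)
    ...   | inj₁ (F≡A∨B , s) =
      loosen (n≤1+n _) (exchange≤ (↭-trans g (++⁺ˡ Ga s)) h (at-L∨ F≡A∨B e₁ e₂))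
    ...   | inj₂ (_ , t , u) =
      let (e₁′ , k₁) = invertL (prefix-↭ [ A ] [ F ] t) (shifts [ A ] Ga) h e₁
          (e₂′ , k₂) = invertL (prefix-↭ [ B ] [ F ] t) (shifts [ B ] Ga) h e₂
      in L∨ (↭-trans g (prefix-↭ Ga [ A ∨' B ] u)) e₁′ e₂′ , s≤s (⊔-mono-≤ k₁ k₂)
    invertL π g h d | by-R∨ {A} {B} p e =
      let (e′ , k) = invertL π g (shifts (A ∷ B ∷ []) Da) e
      in R∨ (↭-trans h (prefix-↭ Da [ A ∨' B ] p)) e′ , s≤s k
    invertL π g h d | by-L⊃ {A} {B} p e₁ e₂ with ∷-↭-inv (↭-sym-trans π p)
    ...   | inj₁ (F≡A⊃B , s) =
      loosen (n≤1+n _) (exchange≤ (↭-trans g (++⁺ˡ Ga s)) h (at-L⊃ F≡A⊃B e₁ e₂))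
    ...   | inj₂ (_ , t , u) =
      let (e₁′ , k₁) = invertL t ↭-refl (↭-trans (↭-prep A h) (shifts [ A ] Da)) e₁
          (e₂′ , k₂) = invertL (prefix-↭ [ B ] [ F ] t) (shifts [ B ] Ga) h e₂
      in L⊃ (↭-trans g (prefix-↭ Ga [ A ⊃ B ] u)) e₁′ e₂′ , s≤s (⊔-mono-≤ k₁ k₂)
    invertL π g h d | by-R⊃ {A} {B} p e =
      let (e′ , k) = invertL (prefix-↭ [ A ] [ F ] π) (↭-trans (↭-prep A g) (shifts [ A ] Ga))
                             (shifts [ B ] Da) e
      in R⊃ (↭-trans h (prefix-↭ Da [ A ⊃ B ] p)) e′ , s≤s k
    invertL π g h d | by-modal me =
      let (_ , r) = outside-image □ (principalL me) not-box (↭-sym-trans π (splitL me))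
      in rebuild me (↭-trans g (prefix-↭ Ga (□s (principalL me)) r))
                    (↭-trans h (prefix-↭ Da (□s (principalR me)) (splitR me)))

  record RightInvertible (F : Fm) (Ga Da : List Fm) : Set where
    field
      not-atom : ∀ n → F ≢ var n
      not-box : ∀ C → F ≢ □ C
      at-R∧ : ∀ {A B Γ Δ} → F ≡ A ∧' B → (e₁ : Deriv X (Γ ⇒ A ∷ Δ)) (e₂ : Deriv X (Γ ⇒ B ∷ Δ)) →
              Deriv≤ (Ga ++ Γ ⇒ Da ++ Δ) (height e₁ ⊔ height e₂)
      at-R∨ : ∀ {A B Γ Δ} → F ≡ A ∨' B → (e : Deriv X (Γ ⇒ A ∷ B ∷ Δ)) →
              Deriv≤ (Ga ++ Γ ⇒ Da ++ Δ) (height e)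
      at-R⊃ : ∀ {A B Γ Δ} → F ≡ A ⊃ B → (e : Deriv X (A ∷ Γ ⇒ B ∷ Δ)) →
              Deriv≤ (Ga ++ Γ ⇒ Da ++ Δ) (height e)

  module _ {F Ga Da} (I : RightInvertible F Ga Da) where
    open RightInvertible I

    invertR : ∀ {Γ Δ Δ₀ Γ′ Δ′} → Δ ↭ F ∷ Δ₀ → Γ′ ↭ Ga ++ Γ → Δ′ ↭ Da ++ Δ₀ →
              (d : Deriv X (Γ ⇒ Δ)) → Deriv≤ (Γ′ ⇒ Δ′) (height d)
    invertR π g h d with view d
    ... | by-init n p q with ∷-↭-inv (↭-sym-trans π q)
    ...   | inj₁ (F≡var , _) = ⊥-elim (not-atom n F≡var)
    ...   | inj₂ (_ , _ , u) =
      init n (↭-trans g (prefix-↭ Ga [ var n ] p)) (↭-trans h (prefix-↭ Da [ var n ] u)) , z≤n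
    invertR π g h d | by-L⊥ p = L⊥ (↭-trans g (prefix-↭ Ga [ ⊥' ] p)) , z≤n
    invertR π g h d | by-L∧ {A} {B} p e =
      let (e′ , k) = invertR π (shifts (A ∷ B ∷ []) Ga) h e
      in L∧ (↭-trans g (prefix-↭ Ga [ A ∧' B ] p)) e′ , s≤s k
    invertR π g h d | by-R∧ {A} {B} p e₁ e₂ with ∷-↭-inv (↭-sym-trans π p)
    ...   | inj₁ (F≡A∧B , s) =
      loosen (n≤1+n _) (exchange≤ g (↭-trans h (++⁺ˡ Da s)) (at-R∧ F≡A∧B e₁ e₂))
    ...   | inj₂ (_ , t , u) =
      let (e₁′ , k₁) = invertR (prefix-↭ [ A ] [ F ] t) g (shifts [ A ] Da) e₁
          (e₂′ , k₂) = invertR (prefix-↭ [ B ] [ F ] t) g (shifts [ B ] Da) e₂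
      in R∧ (↭-trans h (prefix-↭ Da [ A ∧' B ] u)) e₁′ e₂′ , s≤s (⊔-mono-≤ k₁ k₂)
    invertR π g h d | by-L∨ {A} {B} p e₁ e₂ =
      let (e₁′ , k₁) = invertR π (shifts [ A ] Ga) h e₁
          (e₂′ , k₂) = invertR π (shifts [ B ] Ga) h e₂
      in L∨ (↭-trans g (prefix-↭ Ga [ A ∨' B ] p)) e₁′ e₂′ , s≤s (⊔-mono-≤ k₁ k₂)
    invertR π g h d | by-R∨ {A} {B} p e with ∷-↭-inv (↭-sym-trans π p)
    ...   | inj₁ (F≡A∨B , s) =
      loosen (n≤1+n _) (exchange≤ g (↭-trans h (++⁺ˡ Da s)) (at-R∨ F≡A∨B e))
    ...   | inj₂ (_ , t , u) =
      let (e′ , k) = invertR (prefix-↭ (A ∷ B ∷ []) [ F ] t) g (shifts (A ∷ B ∷ []) Da) e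
      in R∨ (↭-trans h (prefix-↭ Da [ A ∨' B ] u)) e′ , s≤s k
    invertR π g h d | by-L⊃ {A} {B} p e₁ e₂ =
      let (e₁′ , k₁) = invertR (prefix-↭ [ A ] [ F ] π) ↭-refl
                               (↭-trans (↭-prep A h) (shifts [ A ] Da)) e₁
          (e₂′ , k₂) = invertR π (shifts [ B ] Ga) h e₂
      in L⊃ (↭-trans g (prefix-↭ Ga [ A ⊃ B ] p)) e₁′ e₂′ , s≤s (⊔-mono-≤ k₁ k₂)
    invertR π g h d | by-R⊃ {A} {B} p e with ∷-↭-inv (↭-sym-trans π p)
    ...   | inj₁ (F≡A⊃B , s) =
      loosen (n≤1+n _) (exchange≤ g (↭-trans h (++⁺ˡ Da s)) (at-R⊃ F≡A⊃B e))
    ...   | inj₂ (_ , t , u) =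
      let (e′ , k) = invertR (prefix-↭ [ B ] [ F ] t) (↭-trans (↭-prep A g) (shifts [ A ] Ga))
                             (shifts [ B ] Da) e
      in R⊃ (↭-trans h (prefix-↭ Da [ A ⊃ B ] u)) e′ , s≤s k
    invertR π g h d | by-modal me =
      let (_ , r) = outside-image □ (principalR me) not-box (↭-sym-trans π (splitR me))
      in rebuild me (↭-trans g (prefix-↭ Ga (□s (principalL me)) (splitL me)))
                    (↭-trans h (prefix-↭ Da (□s (principalR me)) r))

  inv-L∧ : ∀ {A B} → LeftInvertible (A ∧' B) (A ∷ B ∷ []) []
  inv-L∧ = record { not-atom = λ _ () ; not-⊥ = λ () ; not-box = λ _ ()
                  ; at-L∧ = λ { refl e → tight e } ; at-L∨ = λ () ; at-L⊃ = λ () }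

  inv-L∨₁ : ∀ {A B} → LeftInvertible (A ∨' B) [ A ] []
  inv-L∨₁ = record { not-atom = λ _ () ; not-⊥ = λ () ; not-box = λ _ ()
                   ; at-L∧ = λ () ; at-L∨ = λ { refl e₁ _ → e₁ , m≤m⊔n _ _ } ; at-L⊃ = λ () }

  inv-L∨₂ : ∀ {A B} → LeftInvertible (A ∨' B) [ B ] []
  inv-L∨₂ = record { not-atom = λ _ () ; not-⊥ = λ () ; not-box = λ _ ()
                   ; at-L∧ = λ () ; at-L∨ = λ { refl _ e₂ → e₂ , m≤n⊔m _ _ } ; at-L⊃ = λ () }

  inv-L⊃₁ : ∀ {A B} → LeftInvertible (A ⊃ B) [] [ A ]
  inv-L⊃₁ = record { not-atom = λ _ () ; not-⊥ = λ () ; not-box = λ _ ()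
                   ; at-L∧ = λ () ; at-L∨ = λ () ; at-L⊃ = λ { refl e₁ _ → e₁ , m≤m⊔n _ _ } }

  inv-L⊃₂ : ∀ {A B} → LeftInvertible (A ⊃ B) [ B ] []
  inv-L⊃₂ = record { not-atom = λ _ () ; not-⊥ = λ () ; not-box = λ _ ()
                   ; at-L∧ = λ () ; at-L∨ = λ () ; at-L⊃ = λ { refl _ e₂ → e₂ , m≤n⊔m _ _ } }

  inv-R∧₁ : ∀ {A B} → RightInvertible (A ∧' B) [] [ A ]
  inv-R∧₁ = record { not-atom = λ _ () ; not-box = λ _ ()
                   ; at-R∧ = λ { refl e₁ _ → e₁ , m≤m⊔n _ _ } ; at-R∨ = λ () ; at-R⊃ = λ () }

  inv-R∧₂ : ∀ {A B} → RightInvertible (A ∧' B) [] [ B ]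
  inv-R∧₂ = record { not-atom = λ _ () ; not-box = λ _ ()
                   ; at-R∧ = λ { refl _ e₂ → e₂ , m≤n⊔m _ _ } ; at-R∨ = λ () ; at-R⊃ = λ () }

  inv-R∨ : ∀ {A B} → RightInvertible (A ∨' B) [] (A ∷ B ∷ [])
  inv-R∨ = record { not-atom = λ _ () ; not-box = λ _ ()
                  ; at-R∧ = λ () ; at-R∨ = λ { refl e → tight e } ; at-R⊃ = λ () }

  inv-R⊃ : ∀ {A B} → RightInvertible (A ⊃ B) [ A ] [ B ]
  inv-R⊃ = record { not-atom = λ _ () ; not-box = λ _ ()
                  ; at-R∧ = λ () ; at-R∨ = λ () ; at-R⊃ = λ { refl e → tight e } }

  -- Contraction of a formula principal in a propositional rule: invert the
  -- premisses and contract the components, which have lower height.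
  principal-L∧ : ∀ {n A B Γ Γ₀ Γ′ Δ} → ContractL n → Γ′ ↭ A ∧' B ∷ Γ₀ → Γ ↭ A ∧' B ∷ Γ₀ →
                 (e : Deriv X (A ∷ B ∷ Γ ⇒ Δ)) → height e < n → Deriv≤ (Γ′ ⇒ Δ) (suc (height e))
  principal-L∧ {A = A} {B} {Γ₀ = Γ₀} ihL out s e lt =
    let (e′ , k) = ihL lt ↭-refl (↭-swap A B ↭-refl)
                 $ ihL lt (↭-prep A (↭-swap B A ↭-refl)) (shift A (B ∷ B ∷ []) Γ₀)
                 $ invertL inv-L∧ (prefix-↭ (A ∷ B ∷ []) [ A ∧' B ] s) ↭-refl ↭-refl e
    in L∧ out e′ , s≤s k

  principal-L∨ : ∀ {n A B Γ Γ₀ Γ′ Δ} → ContractL n → Γ′ ↭ A ∨' B ∷ Γ₀ → Γ ↭ A ∨' B ∷ Γ₀ →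
                 (e₁ : Deriv X (A ∷ Γ ⇒ Δ)) (e₂ : Deriv X (B ∷ Γ ⇒ Δ)) → height e₁ ⊔ height e₂ < n →
                 Deriv≤ (Γ′ ⇒ Δ) (suc (height e₁ ⊔ height e₂))
  principal-L∨ {A = A} {B} ihL out s e₁ e₂ lt =
    let (e₁′ , k₁) = ihL (⊔-<ˡ lt) ↭-refl ↭-refl
                   $ invertL inv-L∨₁ (prefix-↭ [ A ] [ A ∨' B ] s) ↭-refl ↭-refl e₁
        (e₂′ , k₂) = ihL (⊔-<ʳ lt) ↭-refl ↭-refl
                   $ invertL inv-L∨₂ (prefix-↭ [ B ] [ A ∨' B ] s) ↭-refl ↭-refl e₂
    in L∨ out e₁′ e₂′ , s≤s (⊔-mono-≤ k₁ k₂)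

  principal-L⊃ : ∀ {n A B Γ Γ₀ Γ′ Δ} → ContractL n → ContractR n →
                 Γ′ ↭ A ⊃ B ∷ Γ₀ → Γ ↭ A ⊃ B ∷ Γ₀ →
                 (e₁ : Deriv X (Γ ⇒ A ∷ Δ)) (e₂ : Deriv X (B ∷ Γ ⇒ Δ)) → height e₁ ⊔ height e₂ < n →
                 Deriv≤ (Γ′ ⇒ Δ) (suc (height e₁ ⊔ height e₂))
  principal-L⊃ {A = A} {B} ihL ihR out s e₁ e₂ lt =
    let (e₁′ , k₁) = ihR (⊔-<ˡ lt) ↭-refl ↭-refl
                   $ invertL inv-L⊃₁ s ↭-refl ↭-refl e₁
        (e₂′ , k₂) = ihL (⊔-<ʳ lt) ↭-refl ↭-refl
                   $ invertL inv-L⊃₂ (prefix-↭ [ B ] [ A ⊃ B ] s) ↭-refl ↭-refl e₂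
    in L⊃ out e₁′ e₂′ , s≤s (⊔-mono-≤ k₁ k₂)

  principal-R∧ : ∀ {n A B Γ Δ Δ₀ Δ′} → ContractR n → Δ′ ↭ A ∧' B ∷ Δ₀ → Δ ↭ A ∧' B ∷ Δ₀ →
                 (e₁ : Deriv X (Γ ⇒ A ∷ Δ)) (e₂ : Deriv X (Γ ⇒ B ∷ Δ)) → height e₁ ⊔ height e₂ < n →
                 Deriv≤ (Γ ⇒ Δ′) (suc (height e₁ ⊔ height e₂))
  principal-R∧ {A = A} {B} ihR out s e₁ e₂ lt =
    let (e₁′ , k₁) = ihR (⊔-<ˡ lt) ↭-refl ↭-refl
                   $ invertR inv-R∧₁ (prefix-↭ [ A ] [ A ∧' B ] s) ↭-refl ↭-refl e₁
        (e₂′ , k₂) = ihR (⊔-<ʳ lt) ↭-refl ↭-refl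
                   $ invertR inv-R∧₂ (prefix-↭ [ B ] [ A ∧' B ] s) ↭-refl ↭-refl e₂
    in R∧ out e₁′ e₂′ , s≤s (⊔-mono-≤ k₁ k₂)

  principal-R∨ : ∀ {n A B Γ Δ Δ₀ Δ′} → ContractR n → Δ′ ↭ A ∨' B ∷ Δ₀ → Δ ↭ A ∨' B ∷ Δ₀ →
                 (e : Deriv X (Γ ⇒ A ∷ B ∷ Δ)) → height e < n → Deriv≤ (Γ ⇒ Δ′) (suc (height e))
  principal-R∨ {A = A} {B} {Δ₀ = Δ₀} ihR out s e lt =
    let (e′ , k) = ihR lt ↭-refl (↭-swap A B ↭-refl)
                 $ ihR lt (↭-prep A (↭-swap B A ↭-refl)) (shift A (B ∷ B ∷ []) Δ₀)
                 $ invertR inv-R∨ (prefix-↭ (A ∷ B ∷ []) [ A ∨' B ] s) ↭-refl ↭-refl e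
    in R∨ out e′ , s≤s k

  principal-R⊃ : ∀ {n A B Γ Δ Δ₀ Δ′} → ContractL n → ContractR n →
                 Δ′ ↭ A ⊃ B ∷ Δ₀ → Δ ↭ A ⊃ B ∷ Δ₀ →
                 (e : Deriv X (A ∷ Γ ⇒ B ∷ Δ)) → height e < n → Deriv≤ (Γ ⇒ Δ′) (suc (height e))
  principal-R⊃ {A = A} {B} ihL ihR out s e lt =
    let (e′ , k) = ihR lt ↭-refl ↭-refl
                 $ ihL lt ↭-refl ↭-refl
                 $ invertR inv-R⊃ (prefix-↭ [ B ] [ A ⊃ B ] s) ↭-refl ↭-refl e
    in R⊃ out e′ , s≤s k

  contractL-step : ∀ {n} → ContractL n → ContractR n → ∀ {Γ Δ A Γ₀ Γ′} →
                   Γ ↭ A ∷ A ∷ Γ₀ → Γ′ ↭ A ∷ Γ₀ → (d : Deriv X (Γ ⇒ Δ)) → height d ≤ n →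
                   Deriv≤ (Γ′ ⇒ Δ) (height d)
  contractL-step ihL ihR {A = A} π out d lt with view d
  ... | by-init n p q = init n (↭-trans out (proj₂ (∷∷-↭-drop (↭-sym-trans π p)))) q , z≤n
  ... | by-L⊥ p = L⊥ (↭-trans out (proj₂ (∷∷-↭-drop (↭-sym-trans π p)))) , z≤n
  ... | by-L∧ {A′} {B′} p e with ∷∷-↭-inv (↭-sym-trans π p)
  ...   | inj₁ (refl , s) = principal-L∧ ihL out s e lt
  ...   | inj₂ (_ , t , u) =
    let (e′ , k) = ihL lt (prefix-↭ (A′ ∷ B′ ∷ []) (A ∷ A ∷ []) t) (shifts (A′ ∷ B′ ∷ []) [ A ])
                       (tight e)
    in L∧ (↭-trans out (prefix-↭ [ A ] [ A′ ∧' B′ ] u)) e′ , s≤s k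
  contractL-step ihL ihR π out d lt | by-R∧ p e₁ e₂ =
    let (e₁′ , k₁) = ihL (⊔-<ˡ lt) π out (tight e₁)
        (e₂′ , k₂) = ihL (⊔-<ʳ lt) π out (tight e₂)
    in R∧ p e₁′ e₂′ , s≤s (⊔-mono-≤ k₁ k₂)
  contractL-step ihL ihR {A = A} π out d lt | by-L∨ {A′} {B′} p e₁ e₂
    with ∷∷-↭-inv (↭-sym-trans π p)
  ...   | inj₁ (refl , s) = principal-L∨ ihL out s e₁ e₂ lt
  ...   | inj₂ (_ , t , u) =
    let (e₁′ , k₁) = ihL (⊔-<ˡ lt) (prefix-↭ [ A′ ] (A ∷ A ∷ []) t) (↭-swap A′ A ↭-refl) (tight e₁)
        (e₂′ , k₂) = ihL (⊔-<ʳ lt) (prefix-↭ [ B′ ] (A ∷ A ∷ []) t) (↭-swap B′ A ↭-refl) (tight e₂)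
    in L∨ (↭-trans out (prefix-↭ [ A ] [ A′ ∨' B′ ] u)) e₁′ e₂′ , s≤s (⊔-mono-≤ k₁ k₂)
  contractL-step ihL ihR π out d lt | by-R∨ p e =
    let (e′ , k) = ihL lt π out (tight e) in R∨ p e′ , s≤s k
  contractL-step ihL ihR {A = A} π out d lt | by-L⊃ {A′} {B′} p e₁ e₂
    with ∷∷-↭-inv (↭-sym-trans π p)
  ...   | inj₁ (refl , s) = principal-L⊃ ihL ihR out s e₁ e₂ lt
  ...   | inj₂ (_ , t , u) =
    let (e₁′ , k₁) = ihL (⊔-<ˡ lt) t ↭-refl (tight e₁)
        (e₂′ , k₂) = ihL (⊔-<ʳ lt) (prefix-↭ [ B′ ] (A ∷ A ∷ []) t) (↭-swap B′ A ↭-refl) (tight e₂)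
    in L⊃ (↭-trans out (prefix-↭ [ A ] [ A′ ⊃ B′ ] u)) e₁′ e₂′ , s≤s (⊔-mono-≤ k₁ k₂)
  contractL-step ihL ihR {A = A} π out d lt | by-R⊃ {A′} p e =
    let (e′ , k) = ihL lt (prefix-↭ [ A′ ] (A ∷ A ∷ []) π) (prefix-↭ [ A′ ] [ A ] out) (tight e)
    in R⊃ p e′ , s≤s k
  contractL-step ihL ihR π out d lt | by-modal me
    with two-copies □ □-injective (principalL me) (↭-sym-trans π (splitL me))
  ...   | inj₁ (_ , r) = rebuild me (↭-trans out r) (splitR me)
  ...   | inj₂ (D , _ , refl , two , u) =
    contract-principal me two lt ihL ihR (↭-trans out (↭-prep (□ D) u)) (splitR me)

  -- Induction step for right contraction; at most one principal formula of a
  -- modal rule is on the right, so there both copies are never principal.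
  contractR-step : ∀ {n} → ContractL n → ContractR n → ∀ {Γ Δ A Δ₀ Δ′} →
                   Δ ↭ A ∷ A ∷ Δ₀ → Δ′ ↭ A ∷ Δ₀ → (d : Deriv X (Γ ⇒ Δ)) → height d ≤ n →
                   Deriv≤ (Γ ⇒ Δ′) (height d)
  contractR-step ihL ihR {A = A} π out d lt with view d
  ... | by-init n p q = init n p (↭-trans out (proj₂ (∷∷-↭-drop (↭-sym-trans π q)))) , z≤n
  ... | by-L⊥ p = L⊥ p , z≤n
  ... | by-L∧ p e =
    let (e′ , k) = ihR lt π out (tight e) in L∧ p e′ , s≤s k
  ... | by-R∧ {A′} {B′} p e₁ e₂ with ∷∷-↭-inv (↭-sym-trans π p)
  ...   | inj₁ (refl , s) = principal-R∧ ihR out s e₁ e₂ lt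
  ...   | inj₂ (_ , t , u) =
    let (e₁′ , k₁) = ihR (⊔-<ˡ lt) (prefix-↭ [ A′ ] (A ∷ A ∷ []) t) (↭-swap A′ A ↭-refl) (tight e₁)
        (e₂′ , k₂) = ihR (⊔-<ʳ lt) (prefix-↭ [ B′ ] (A ∷ A ∷ []) t) (↭-swap B′ A ↭-refl) (tight e₂)
    in R∧ (↭-trans out (prefix-↭ [ A ] [ A′ ∧' B′ ] u)) e₁′ e₂′ , s≤s (⊔-mono-≤ k₁ k₂)
  contractR-step ihL ihR π out d lt | by-L∨ p e₁ e₂ =
    let (e₁′ , k₁) = ihR (⊔-<ˡ lt) π out (tight e₁)
        (e₂′ , k₂) = ihR (⊔-<ʳ lt) π out (tight e₂)
    in L∨ p e₁′ e₂′ , s≤s (⊔-mono-≤ k₁ k₂)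
  contractR-step ihL ihR {A = A} π out d lt | by-R∨ {A′} {B′} p e with ∷∷-↭-inv (↭-sym-trans π p)
  ...   | inj₁ (refl , s) = principal-R∨ ihR out s e lt
  ...   | inj₂ (_ , t , u) =
    let (e′ , k) = ihR lt (prefix-↭ (A′ ∷ B′ ∷ []) (A ∷ A ∷ []) t) (shifts (A′ ∷ B′ ∷ []) [ A ])
                       (tight e)
    in R∨ (↭-trans out (prefix-↭ [ A ] [ A′ ∨' B′ ] u)) e′ , s≤s k
  contractR-step ihL ihR {A = A} π out d lt | by-L⊃ {A′} p e₁ e₂ =
    let (e₁′ , k₁) = ihR (⊔-<ˡ lt) (prefix-↭ [ A′ ] (A ∷ A ∷ []) π) (prefix-↭ [ A′ ] [ A ] out)
                         (tight e₁)
        (e₂′ , k₂) = ihR (⊔-<ʳ lt) π out (tight e₂)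
    in L⊃ p e₁′ e₂′ , s≤s (⊔-mono-≤ k₁ k₂)
  contractR-step ihL ihR {A = A} π out d lt | by-R⊃ {A′} {B′} p e with ∷∷-↭-inv (↭-sym-trans π p)
  ...   | inj₁ (refl , s) = principal-R⊃ ihL ihR out s e lt
  ...   | inj₂ (_ , t , u) =
    let (e′ , k) = ihR lt (prefix-↭ [ B′ ] (A ∷ A ∷ []) t) (↭-swap B′ A ↭-refl) (tight e)
    in R⊃ (↭-trans out (prefix-↭ [ A ] [ A′ ⊃ B′ ] u)) e′ , s≤s k
  contractR-step ihL ihR π out d lt | by-modal me
    with two-copies □ □-injective (principalR me) (↭-sym-trans π (splitR me))
  ...   | inj₁ (_ , r) = rebuild me (splitL me) (↭-trans out r)
  ...   | inj₂ (_ , _ , _ , two , _) = ⊥-elim (≤1-no-copies (single-right me) two)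

  contraction : ∀ n → ContractL n × ContractR n
  contraction zero = (λ ()) , (λ ())
  contraction (suc n) with contraction n
  ... | ihL , ihR = stepL , stepR
    where
      stepL : ContractL (suc n)
      stepL m≤n π out (d , k) = loosen k (contractL-step ihL ihR π out d (≤-trans k (≤-pred m≤n)))

      stepR : ContractR (suc n)
      stepR m≤n π out (d , k) = loosen k (contractR-step ihL ihR π out d (≤-trans k (≤-pred m≤n)))

  contractL : ∀ {A Γ Δ} (d : Deriv X (A ∷ A ∷ Γ ⇒ Δ)) → Deriv≤ (A ∷ Γ ⇒ Δ) (height d)
  contractL d = proj₁ (contraction (suc (height d))) ≤-refl ↭-refl ↭-refl (tight d)

  contractR : ∀ {A Γ Δ} (d : Deriv X (Γ ⇒ A ∷ A ∷ Δ)) → Deriv≤ (Γ ⇒ A ∷ Δ) (height d)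
  contractR d = proj₂ (contraction (suc (height d))) ≤-refl ↭-refl ↭-refl (tight d)

theorem3 : (X : Calculus) →
    (∀ A Γ Δ (d : Deriv X (A ∷ A ∷ Γ ⇒ Δ)) →
       Σ[ d' ∈ Deriv X (A ∷ Γ ⇒ Δ) ] height d' ≤ height d)
    × (∀ A Γ Δ (d : Deriv X (Γ ⇒ A ∷ A ∷ Δ)) →
       Σ[ d' ∈ Deriv X (Γ ⇒ A ∷ Δ) ] height d' ≤ height d)
theorem3 X = (λ A Γ Δ d → contractL X d) , (λ A Γ Δ d → contractR X d)
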